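{- Let $K$ be an idempotent, linearly ordered, archimedian, cancellative commutative semiring and let $u,q,v,w\in K$. If $v(wX)^*\leq u(qX)^*$ in $K[[X]]$, then $v=\mathbb{0}$ or ($v\leq u$ and $w\leq q$).
   Context: Idempotent: $u\oplus u=u$; linearly ordered: $u\leq v\iff u\oplus v=v$ is a linear order; archimedian: $u\lambda^k\geq v\mu^k$ for all $k\geq0$ implies $v=\mathbb{0}$ or $\lambda\geq\mu$; cancellative: $uv=u'v$ implies $v=\mathbb{0}$ or $u=u'$. For $a\in K$, $(aX)^*=\bigoplus_{k\geq0}a^kX^k\in K[[X]]$, so $v(wX)^*$ is the series with $k$-th coefficient $vw^k$. Series are compared coefficientwise: $T\leq T'$ iff $\langle T,X^k\rangle\leq\langle T',X^k\rangle$ for all $k$. -}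

module Defs where

open import Level using (Level)
open import Data.Nat using (ℕ; zero; suc)
open import Data.Sum using (_⊎_)
open import Algebra.Bundles using (CommutativeSemiring)

module _ {c ℓ : Level} (K : CommutativeSemiring c ℓ) where
  open CommutativeSemiring K

  _≼_ : Carrier → Carrier → Set ℓ
  u ≼ v = (u + v) ≈ v

  pow : Carrier → ℕ → Carrier
  pow a zero = 1#
  pow a (suc k) = a * pow a k

  -- k-th coefficient of the series  v (w X)^*  is  v w^k
  coeffStar : Carrier → Carrier → ℕ → Carrier
  coeffStar v w k = v * pow w k

  -- coefficientwise order on K[[X]]:  v (wX)^* ≤ u (qX)^*
  StarLeq : Carrier → Carrier → Carrier → Carrier → Set ℓ
  StarLeq v w u q = ∀ (k : ℕ) → coeffStar v w k ≼ coeffStar u q k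

  Idempotent : Set (c Level.⊔ ℓ)
  Idempotent = ∀ (u : Carrier) → (u + u) ≈ u

  LinearlyOrdered : Set (c Level.⊔ ℓ)
  LinearlyOrdered = ∀ (u v : Carrier) → (u ≼ v) ⊎ (v ≼ u)

  Archimedian : Set (c Level.⊔ ℓ)
  Archimedian = ∀ (u v lam mu : Carrier) →
    (∀ (k : ℕ) → (v * pow mu k) ≼ (u * pow lam k)) → (v ≈ 0#) ⊎ (mu ≼ lam)

  Cancellative : Set (c Level.⊔ ℓ)
  Cancellative = ∀ (u u' v : Carrier) → (u * v) ≈ (u' * v) → (v ≈ 0#) ⊎ (u ≈ u')

module Submission where

-- If  v (wX)^* ≤ u (qX)^*  coefficientwise, i.e.  v w^k ≤ u q^k  for every k,
-- then the two conclusions come from two different coefficients: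
--   * the constant coefficient (k = 0) gives  v ≤ u  directly, in any
--     commutative semiring (`leadingCoefficient≼`);
--   * the whole family of inequalities is exactly the hypothesis of the
--     archimedian property with λ = q, μ = w, which yields  v = 0  or  w ≤ q.

open import Defs
open import Level using (Level)
open import Data.Sum using (_⊎_; map₂)
open import Data.Product using (_×_; _,_)
open import Algebra.Bundles using (CommutativeSemiring)
import Relation.Binary.Reasoning.Setoid as SetoidReasoning

module _ {c ℓ : Level} (K : CommutativeSemiring c ℓ) where
  open CommutativeSemiring K
  open SetoidReasoning setoid

  leadingCoefficient≼ : ∀ (u q v w : Carrier) → StarLeq K v w u q → _≼_ K v u
  leadingCoefficient≼ u q v w v*≤u* = begin
    v + u             ≈⟨ +-cong (sym (*-identityʳ v)) (sym (*-identityʳ u)) ⟩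
    v * 1# + u * 1#   ≈⟨ v*≤u* 0 ⟩
    u * 1#            ≈⟨ *-identityʳ u ⟩
    u                 ∎

lemma5 : ∀ {c ℓ : Level} (K : CommutativeSemiring c ℓ) →
    Idempotent K → LinearlyOrdered K → Archimedian K → Cancellative K →
    ∀ (u q v w : CommutativeSemiring.Carrier K) →
    StarLeq K v w u q →
    (CommutativeSemiring._≈_ K v (CommutativeSemiring.0# K)) ⊎ (_≼_ K v u × _≼_ K w q)
lemma5 K _ _ arch _ u q v w v*≤u* =
  map₂ (leadingCoefficient≼ K u q v w v*≤u* ,_) (arch u v q w v*≤u*)
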